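{- Let $S^{(0)}=1$ and, for $i\in\mathbb{N}$, let $S^{(i+1)}=S^{(i)}0^{|S^{(i)}|}S^{(i)}$ (the concatenation of $S^{(i)}$, a block of $|S^{(i)}|$ zeros, and $S^{(i)}$ again). Let $x$ be the Cantor string, i.e. the unique right-infinite binary string having every $S^{(i)}$ as an initial segment. Then $p_x(n)=2n-1$ for all integers $n>1$.
   Context: For a binary string $s$ and a positive integer $n$, $p_s(n)$ denotes the number of distinct (contiguous) substrings of $s$ of length $n$. $0^k$ denotes a string of $k$ zeros and $|w|$ the length of a word $w$. -}

module Defs where

open import Data.Bool using (Bool; true; false)
open import Data.Nat using (ℕ; zero; suc; _+_)
open import Data.List using (List; []; _∷_; _++_; length; replicate)
open import Data.Maybe using (Maybe; just; nothing)
open import Data.Product using (_×_; ∃)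
open import Relation.Binary.PropositionalEquality using (_≡_)
open import Data.List.Relation.Unary.Unique.Propositional using (Unique)
open import Data.List.Membership.Propositional using (_∈_)

-- Binary symbols: false = 0, true = 1.

S : ℕ → List Bool
S zero = true ∷ []
S (suc i) = S i ++ (replicate (length (S i)) false ++ S i)

nth : ℕ → List Bool → Maybe Bool
nth _ [] = nothing
nth zero (b ∷ _) = just b
nth (suc k) (_ ∷ w) = nth k w

fromMaybe0 : Maybe Bool → Bool
fromMaybe0 (just b) = b
fromMaybe0 nothing = false

IsPrefixOf : List Bool → (ℕ → Bool) → Set
IsPrefixOf w x = ∀ k b → nth k w ≡ just b → x k ≡ b

-- The Cantor string: position k is read off S^(k+1), which has length 3^(k+1) > k.
-- (That this x has every S^(i) as a prefix is part of the paper's setup.)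
cantor : ℕ → Bool
cantor k = fromMaybe0 (nth k (S (suc k)))

factor : (ℕ → Bool) → ℕ → ℕ → List Bool
factor x i zero = []
factor x i (suc n) = x i ∷ factor x (suc i) n

IsFactor : (ℕ → Bool) → ℕ → List Bool → Set
IsFactor x n w = ∃ λ i → factor x i n ≡ w

-- p_x(n) = k : the set of distinct length-n factors of x has exactly k elements,
-- i.e. there is a duplicate-free list of length k whose members are exactly those factors.
Complexity : (ℕ → Bool) → ℕ → ℕ → Set
Complexity x n k = ∃ λ (ws : List (List Bool)) →
  Unique ws × length ws ≡ k × (∀ w → (w ∈ ws → IsFactor x n w) × (IsFactor x n w → w ∈ ws))

-- The letter of x at position k is 1 exactly when the ternary expansion of k avoids the digit 1; in
-- particular the letter at C·3^m + r (r < 3^m) is the product of the letters at C and at r. Every factor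
-- reoccurs further right, so it has a left extension, and p(n+1) − p(n) is the number of left special
-- factors of length n. For 3^a < n ≤ 3^(a+1) these are 0^n and the factor at position 3^a: in an
-- occurrence of 1w the 1 is followed by exactly 3^b zeros and a 1, and a run of more than 3^b zeros
-- ending in a 1 ends at a multiple of 3^(b+1), so the occurrences of 0w and 1w read the same blocks,
-- which forces n ≤ 3^(b+1), i.e. b = a. Starting from p(2) = 3 this gives p(n) = 2n − 1.
module Submission where

open import Defs
open import Data.Bool using (Bool; true; false; _∧_)
open import Data.Bool.Properties using (∧-assoc; ∧-identityʳ; ∧-zeroʳ) renaming (_≟_ to _≟ᵇ_)
open import Data.Nat using (ℕ; zero; suc; pred; _+_; _*_; _∸_; _^_; _≤_; _<_; _≤?_; z≤n; s≤s; NonZero)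
open import Data.Nat.Properties
open import Data.Nat.DivMod using (_/_; _%_; m≡m%n+[m/n]*n; m%n<n; m<n*o⇒m/o<n)
open import Data.Nat.Tactic.RingSolver using (solve-∀)
open import Data.List using (List; []; _∷_; _++_; length; replicate; filter)
open import Data.List.Properties using (∷-injective; ∷-injectiveˡ; ∷-injectiveʳ; ≡-dec; length-++)
open import Data.List.Membership.Propositional using (_∈_)
open import Data.List.Membership.Propositional.Properties using (∈-++⁻; ∈-++⁺ˡ; ∈-++⁺ʳ; ∈-filter⁺; ∈-filter⁻)
open import Data.List.Membership.Propositional.Properties.WithK using (unique∧set⇒bag)
open import Data.List.Membership.DecPropositional (≡-dec _≟ᵇ_) using (_∈?_)
open import Data.List.Relation.Unary.Any using (here; there)
open import Data.List.Relation.Unary.All using (All; []; _∷_; tabulate)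
open import Data.List.Relation.Unary.AllPairs using ([]; _∷_)
open import Data.List.Relation.Unary.Unique.Propositional using (Unique)
open import Data.List.Relation.Unary.Unique.Propositional.Properties using (++⁺; filter⁺; Unique[x∷xs]⇒x∉xs)
open import Data.List.Relation.Binary.BagAndSetEquality using (∼bag⇒↭)
open import Data.List.Relation.Binary.Permutation.Propositional.Properties using (↭-length)
open import Data.Maybe using (just)
open import Data.Maybe.Properties using (just-injective)
import Data.Maybe as Maybe
open import Data.Product using (_×_; _,_; proj₁; proj₂; ∃; ∃₂; map₂)
open import Data.Sum using (_⊎_; inj₁; inj₂)
open import Function using (_∘_)
open import Function.Bundles using (_⇔_; mk⇔; Equivalence)
open import Relation.Nullary using (yes; no; ¬_; contradiction)
open import Relation.Binary.Definitions using (tri<; tri≈; tri>)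
open import Relation.Binary.PropositionalEquality

-- Left special factors and the growth of factor complexity

LeftSpecial : (ℕ → Bool) → ℕ → List Bool → Set
LeftSpecial x n w = IsFactor x (suc n) (false ∷ w) × IsFactor x (suc n) (true ∷ w)

LeftExtendable : (ℕ → Bool) → ℕ → Set
LeftExtendable x n = ∀ w → IsFactor x n w → ∃ λ b → IsFactor x (suc n) (b ∷ w)

isFactor-tail : ∀ {x n b w} → IsFactor x (suc n) (b ∷ w) → IsFactor x n w
isFactor-tail (i , eq) = suc i , proj₂ (∷-injective eq)

factor-pointwise : ∀ {x y : ℕ → Bool} i j n → factor x i n ≡ factor y j n →
                   ∀ {t} → t < n → x (i + t) ≡ y (j + t)
factor-pointwise {x} {y} i j (suc n) eq {zero} _ =
  trans (cong x (+-identityʳ i)) (trans (∷-injectiveˡ eq) (cong y (sym (+-identityʳ j))))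
factor-pointwise {x} {y} i j (suc n) eq {suc t} (s≤s t<n) =
  trans (cong x (+-suc i t))
        (trans (factor-pointwise (suc i) (suc j) n (∷-injectiveʳ eq) t<n) (cong y (sym (+-suc j t))))

factor-cong : ∀ {x y : ℕ → Bool} i j n → (∀ {t} → t < n → x (i + t) ≡ y (j + t)) →
              factor x i n ≡ factor y j n
factor-cong i j zero _ = refl
factor-cong {x} {y} i j (suc n) agree = cong₂ _∷_
  (trans (cong x (sym (+-identityʳ i))) (trans (agree (s≤s z≤n)) (cong y (+-identityʳ j))))
  (factor-cong (suc i) (suc j) n λ {t} t<n →
    trans (cong x (sym (+-suc i t))) (trans (agree (s≤s t<n)) (cong y (+-suc j t))))

factor-const : ∀ b i n → factor (λ _ → b) i n ≡ replicate n b
factor-const b i zero = refl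
factor-const b i (suc n) = cong (b ∷_) (factor-const b (suc i) n)

factor-replicate : ∀ {x : ℕ → Bool} {b} i n → (∀ {t} → t < n → x (i + t) ≡ b) →
                   factor x i n ≡ replicate n b
factor-replicate {b = b} i n const = trans (factor-cong i 0 n const) (factor-const b 0 n)

unique∧set⇒length≡ : ∀ {A : Set} {xs ys : List A} → Unique xs → Unique ys →
                     (∀ {z} → z ∈ xs ⇔ z ∈ ys) → length xs ≡ length ys
unique∧set⇒length≡ uxs uys xs⇔ys = ↭-length (∼bag⇒↭ (unique∧set⇒bag uxs uys xs⇔ys))

module LeftExtensions (x : ℕ → Bool) (n : ℕ) (specials : List (List Bool))
                      (special⇔ : ∀ {w} → w ∈ specials ⇔ LeftSpecial x n w)
                      (extendable : LeftExtendable x n) where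

  open Equivalence

  extensionsOf : ∀ w → IsFactor x n w → List (List Bool)
  extensionsOf w fw with w ∈? specials
  ... | yes _ = (false ∷ w) ∷ (true ∷ w) ∷ []
  ... | no _ = (proj₁ (extendable w fw) ∷ w) ∷ []

  extensions : ∀ {ws} → All (IsFactor x n) ws → List (List Bool)
  extensions [] = []
  extensions {w ∷ _} (fw ∷ fws) = extensionsOf w fw ++ extensions fws

  ∈-extensionsOf⁻ : ∀ {v w} (fw : IsFactor x n w) → v ∈ extensionsOf w fw →
                    IsFactor x (suc n) v × ∃ λ b → v ≡ b ∷ w
  ∈-extensionsOf⁻ {w = w} fw v∈ with w ∈? specials
  ∈-extensionsOf⁻ fw (here refl) | yes w∈ = proj₁ (to special⇔ w∈) , false , refl
  ∈-extensionsOf⁻ fw (there (here refl)) | yes w∈ = proj₂ (to special⇔ w∈) , true , refl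
  ∈-extensionsOf⁻ fw (here refl) | no _ = proj₂ (extendable _ fw) , _ , refl

  distinct-extensions⇒special : ∀ {b b′ w} → ¬ b ≡ b′ → IsFactor x (suc n) (b ∷ w) →
                                IsFactor x (suc n) (b′ ∷ w) → LeftSpecial x n w
  distinct-extensions⇒special {false} {false} b≢b′ _ _ = contradiction refl b≢b′
  distinct-extensions⇒special {false} {true} _ f t = f , t
  distinct-extensions⇒special {true} {false} _ t f = f , t
  distinct-extensions⇒special {true} {true} b≢b′ _ _ = contradiction refl b≢b′

  ∈-extensionsOf⁺ : ∀ {b w} (fw : IsFactor x n w) → IsFactor x (suc n) (b ∷ w) → b ∷ w ∈ extensionsOf w fw
  ∈-extensionsOf⁺ {b} {w} fw fbw with w ∈? specials
  ∈-extensionsOf⁺ {false} fw fbw | yes _ = here refl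
  ∈-extensionsOf⁺ {true} fw fbw | yes _ = there (here refl)
  ... | no w∉ with b′ , fb′w ← extendable w fw | b′ ≟ᵇ b
  ... | yes refl = here refl
  ... | no b′≢b = contradiction (from special⇔ (distinct-extensions⇒special b′≢b fb′w fbw)) w∉

  unique-extensionsOf : ∀ {w} (fw : IsFactor x n w) → Unique (extensionsOf w fw)
  unique-extensionsOf {w} fw with w ∈? specials
  ... | yes _ = ((λ ()) ∷ []) ∷ [] ∷ []
  ... | no _ = [] ∷ []

  length-extensionsOf : ∀ {w} (fw : IsFactor x n w) (ws : List (List Bool)) →
    length (extensionsOf w fw) + length (filter (_∈? specials) ws) ≡ suc (length (filter (_∈? specials) (w ∷ ws)))
  length-extensionsOf {w} fw ws with w ∈? specials
  ... | yes _ = refl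
  ... | no _ = refl

  length-extensions : ∀ {ws} (fws : All (IsFactor x n) ws) →
                      length (extensions fws) ≡ length (filter (_∈? specials) ws) + length ws
  length-extensions [] = refl
  length-extensions {w ∷ ws} (fw ∷ fws) = begin
    length (extensionsOf w fw ++ extensions fws)
      ≡⟨ length-++ (extensionsOf w fw) ⟩
    length (extensionsOf w fw) + length (extensions fws)
      ≡⟨ cong (length (extensionsOf w fw) +_) (length-extensions fws) ⟩
    length (extensionsOf w fw) + (length (filter (_∈? specials) ws) + length ws)
      ≡⟨ sym (+-assoc (length (extensionsOf w fw)) _ _) ⟩
    length (extensionsOf w fw) + length (filter (_∈? specials) ws) + length ws
      ≡⟨ cong (_+ length ws) (length-extensionsOf fw ws) ⟩
    suc (length (filter (_∈? specials) (w ∷ ws))) + length ws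
      ≡⟨ sym (+-suc _ (length ws)) ⟩
    length (filter (_∈? specials) (w ∷ ws)) + length (w ∷ ws) ∎
    where open ≡-Reasoning

  ∈-extensions⁻ : ∀ {ws v} (fws : All (IsFactor x n) ws) → v ∈ extensions fws →
                  IsFactor x (suc n) v × ∃₂ λ b u → v ≡ b ∷ u × u ∈ ws
  ∈-extensions⁻ {w ∷ ws} (fw ∷ fws) v∈ with ∈-++⁻ (extensionsOf w fw) v∈
  ... | inj₁ v∈w with fv , b , refl ← ∈-extensionsOf⁻ fw v∈w = fv , b , w , refl , here refl
  ... | inj₂ v∈ws with fv , b , u , refl , u∈ ← ∈-extensions⁻ fws v∈ws = fv , b , u , refl , there u∈

  ∈-extensions⁺ : ∀ {ws b w} (fws : All (IsFactor x n) ws) → IsFactor x (suc n) (b ∷ w) → w ∈ ws →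
                  b ∷ w ∈ extensions fws
  ∈-extensions⁺ (fw ∷ fws) fbw (here refl) = ∈-++⁺ˡ (∈-extensionsOf⁺ fw fbw)
  ∈-extensions⁺ {w′ ∷ _} (fw ∷ fws) fbw (there w∈) = ∈-++⁺ʳ (extensionsOf w′ fw) (∈-extensions⁺ fws fbw w∈)

  unique-extensions : ∀ {ws} (fws : All (IsFactor x n) ws) → Unique ws → Unique (extensions fws)
  unique-extensions [] [] = []
  unique-extensions {w ∷ ws} (fw ∷ fws) uws@(_ ∷ uws′) =
    ++⁺ (unique-extensionsOf fw) (unique-extensions fws uws′) disjoint
    where
    disjoint : ∀ {v} → ¬ (v ∈ extensionsOf w fw × v ∈ extensions fws)
    disjoint (v∈w , v∈ws)
      with _ , b , refl ← ∈-extensionsOf⁻ fw v∈w | _ , _ , _ , refl , w∈ws ← ∈-extensions⁻ fws v∈ws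
      = Unique[x∷xs]⇒x∉xs uws w∈ws

  complexity-suc : Unique specials → ∀ {k} → Complexity x n k → Complexity x (suc n) (k + length specials)
  complexity-suc uniq-specials {k} (ws , uws , |ws|≡k , factor⇔) =
    extensions fws , unique-extensions fws uws , |extensions|≡ , extension⇔
    where
    fws : All (IsFactor x n) ws
    fws = tabulate (proj₁ (factor⇔ _))

    special⇒∈ws : ∀ {w} → w ∈ specials → w ∈ ws
    special⇒∈ws w∈ = proj₂ (factor⇔ _) (isFactor-tail (proj₁ (to special⇔ w∈)))

    |filter|≡|specials| : length (filter (_∈? specials) ws) ≡ length specials
    |filter|≡|specials| = unique∧set⇒length≡ (filter⁺ (_∈? specials) uws) uniq-specials
      (mk⇔ (proj₂ ∘ ∈-filter⁻ (_∈? specials) {xs = ws})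
           (λ w∈ → ∈-filter⁺ (_∈? specials) (special⇒∈ws w∈) w∈))

    |extensions|≡ : length (extensions fws) ≡ k + length specials
    |extensions|≡ = trans (length-extensions fws) (trans (cong₂ _+_ |filter|≡|specials| |ws|≡k) (+-comm _ k))

    extension⇔ : ∀ v → (v ∈ extensions fws → IsFactor x (suc n) v) ×
                       (IsFactor x (suc n) v → v ∈ extensions fws)
    extension⇔ v = proj₁ ∘ ∈-extensions⁻ fws ,
                   λ { (i , refl) → ∈-extensions⁺ fws (i , refl) (proj₂ (factor⇔ _) (suc i , refl)) }

-- Ternary structure of the Cantor string

σ : List Bool → List Bool
σ [] = []
σ (b ∷ w) = b ∷ false ∷ b ∷ σ w

σ-++ : ∀ u v → σ (u ++ v) ≡ σ u ++ σ v
σ-++ [] v = refl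
σ-++ (b ∷ u) v = cong (λ w → b ∷ false ∷ b ∷ w) (σ-++ u v)

σ-replicate : ∀ k → σ (replicate k false) ≡ replicate (3 * k) false
σ-replicate zero = refl
σ-replicate (suc k) = begin
  false ∷ false ∷ false ∷ σ (replicate k false) ≡⟨ cong (λ w → false ∷ false ∷ false ∷ w) (σ-replicate k) ⟩
  replicate (3 + 3 * k) false                  ≡⟨ cong (λ l → replicate l false) (sym (*-suc 3 k)) ⟩
  replicate (3 * suc k) false                  ∎
  where open ≡-Reasoning

length-σ : ∀ w → length (σ w) ≡ 3 * length w
length-σ [] = refl
length-σ (b ∷ w) = trans (cong (3 +_) (length-σ w)) (sym (*-suc 3 (length w)))

S-suc : ∀ i → S (suc i) ≡ σ (S i)
S-suc zero = refl
S-suc (suc i) = begin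
  S (suc i) ++ replicate (length (S (suc i))) false ++ S (suc i)
    ≡⟨ cong (λ w → w ++ replicate (length w) false ++ w) (S-suc i) ⟩
  σ (S i) ++ replicate (length (σ (S i))) false ++ σ (S i)
    ≡⟨ cong (λ l → σ (S i) ++ replicate l false ++ σ (S i)) (length-σ (S i)) ⟩
  σ (S i) ++ replicate (3 * length (S i)) false ++ σ (S i)
    ≡⟨ cong (λ w → σ (S i) ++ w ++ σ (S i)) (sym (σ-replicate (length (S i)))) ⟩
  σ (S i) ++ σ (replicate (length (S i)) false) ++ σ (S i)
    ≡⟨ cong (σ (S i) ++_) (sym (σ-++ (replicate (length (S i)) false) (S i))) ⟩
  σ (S i) ++ σ (replicate (length (S i)) false ++ S i)
    ≡⟨ sym (σ-++ (S i) _) ⟩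
  σ (S (suc i)) ∎
  where open ≡-Reasoning

length-S : ∀ i → length (S i) ≡ 3 ^ i
length-S zero = refl
length-S (suc i) = trans (cong length (S-suc i)) (trans (length-σ (S i)) (cong (3 *_) (length-S i)))

nth-++ˡ : ∀ {k b} u v → nth k u ≡ just b → nth k (u ++ v) ≡ just b
nth-++ˡ {zero} (c ∷ u) v eq = eq
nth-++ˡ {suc k} (c ∷ u) v eq = nth-++ˡ u v eq

nth-defined : ∀ {k} w → k < length w → ∃ λ b → nth k w ≡ just b
nth-defined {zero} (b ∷ w) _ = b , refl
nth-defined {suc k} (_ ∷ w) (s≤s k<) = nth-defined w k<

nth-S-+ : ∀ d {k i b} → nth k (S i) ≡ just b → nth k (S (d + i)) ≡ just b
nth-S-+ zero eq = eq
nth-S-+ (suc d) eq = nth-++ˡ (S (d + _)) _ (nth-S-+ d eq)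

n<3^n : ∀ n → n < 3 ^ n
n<3^n zero = s≤s z≤n
n<3^n (suc n) = <-≤-trans (s≤s (n<3^n n)) (^-monoʳ-< 3 (s≤s (s≤s z≤n)) (n<1+n n))

nth-S-defined : ∀ {k} i → k < 3 ^ i → ∃ λ b → nth k (S i) ≡ just b
nth-S-defined {k} i k< = nth-defined (S i) (subst (k <_) (sym (length-S i)) k<)

nth-S : ∀ {k} i → k < 3 ^ i → nth k (S i) ≡ just (cantor k)
nth-S {k} i k< with b , eqb ← nth-S-defined i k< | c , eqc ← nth-S-defined (suc k) (<-trans (n<1+n k) (n<3^n (suc k)))
  = begin
  nth k (S i)             ≡⟨ eqb ⟩
  just b                  ≡⟨ sym (nth-S-+ (suc k) eqb) ⟩
  nth k (S (suc k + i))   ≡⟨ cong (λ j → nth k (S j)) (+-comm (suc k) i) ⟩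
  nth k (S (i + suc k))   ≡⟨ nth-S-+ i eqc ⟩
  just c                  ≡⟨ cong (just ∘ fromMaybe0) (sym eqc) ⟩
  just (cantor k)         ∎
  where open ≡-Reasoning

-- cantor 0, cantor 1, cantor 2 are 1, 0, 1, so σ b = (b ∧ cantor 0) (b ∧ cantor 1) (b ∧ cantor 2).
nth-σ : ∀ q {d} w → d < 3 → nth (3 * q + d) (σ w) ≡ Maybe.map (_∧ cantor d) (nth q w)
nth-σ _ [] _ = refl
nth-σ zero {0} (true ∷ w) _ = refl
nth-σ zero {0} (false ∷ w) _ = refl
nth-σ zero {1} (true ∷ w) _ = refl
nth-σ zero {1} (false ∷ w) _ = refl
nth-σ zero {2} (true ∷ w) _ = refl
nth-σ zero {2} (false ∷ w) _ = refl
nth-σ zero {suc (suc (suc _))} (_ ∷ _) (s≤s (s≤s (s≤s ())))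
nth-σ (suc q) {d} (b ∷ w) d<3 =
  trans (cong (λ k → nth k (σ (b ∷ w))) (3[1+q]+d q d)) (nth-σ q w d<3)
  where
  3[1+q]+d : ∀ q d → 3 * suc q + d ≡ 3 + (3 * q + d)
  3[1+q]+d = solve-∀

3q+d<3^[1+q] : ∀ q {d} → d < 3 → 3 * q + d < 3 ^ suc q
3q+d<3^[1+q] q {d} d<3 = begin-strict
  3 * q + d   <⟨ +-monoʳ-< (3 * q) d<3 ⟩
  3 * q + 3   ≡⟨ +-comm (3 * q) 3 ⟩
  3 + 3 * q   ≡⟨ sym (*-suc 3 q) ⟩
  3 * suc q   ≤⟨ *-monoʳ-≤ 3 (n<3^n q) ⟩
  3 ^ suc q   ∎
  where open ≤-Reasoning

cantor-digit : ∀ q {d} → d < 3 → cantor (3 * q + d) ≡ cantor q ∧ cantor d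
cantor-digit q {d} d<3 = just-injective (begin
  just (cantor (3 * q + d))           ≡⟨ sym (nth-S (suc q) (3q+d<3^[1+q] q d<3)) ⟩
  nth (3 * q + d) (S (suc q))         ≡⟨ cong (nth (3 * q + d)) (S-suc q) ⟩
  nth (3 * q + d) (σ (S q))           ≡⟨ nth-σ q (S q) d<3 ⟩
  Maybe.map (_∧ cantor d) (nth q (S q)) ≡⟨ cong (Maybe.map (_∧ cantor d)) (nth-S q (n<3^n q)) ⟩
  just (cantor q ∧ cantor d)          ∎)
  where open ≡-Reasoning

cantor-3q : ∀ q → cantor (3 * q) ≡ cantor q
cantor-3q q =
  trans (cong cantor (sym (+-identityʳ (3 * q)))) (trans (cantor-digit q (s≤s z≤n)) (∧-identityʳ (cantor q)))

cantor-3q+1 : ∀ q → cantor (3 * q + 1) ≡ false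
cantor-3q+1 q = trans (cantor-digit q (s≤s (s≤s z≤n))) (∧-zeroʳ (cantor q))

cantor-3q+2 : ∀ q → cantor (3 * q + 2) ≡ cantor q
cantor-3q+2 q = trans (cantor-digit q (s≤s (s≤s (s≤s z≤n)))) (∧-identityʳ (cantor q))

cantor-block : ∀ m C {r} → r < 3 ^ m → cantor (C * 3 ^ m + r) ≡ cantor C ∧ cantor r
cantor-block zero C (s≤s z≤n) =
  trans (cong cantor (trans (+-identityʳ (C * 1)) (*-identityʳ C))) (sym (∧-identityʳ (cantor C)))
cantor-block (suc m) C {r} r< = begin
  cantor (C * 3 ^ suc m + r)            ≡⟨ cong (λ r → cantor (C * 3 ^ suc m + r)) r≡3q+d ⟩
  cantor (C * 3 ^ suc m + (3 * q + d))  ≡⟨ cong cantor (regroup C (3 ^ m) q d) ⟩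
  cantor (3 * (C * 3 ^ m + q) + d)      ≡⟨ cantor-digit (C * 3 ^ m + q) (m%n<n r 3) ⟩
  cantor (C * 3 ^ m + q) ∧ cantor d     ≡⟨ cong (_∧ cantor d) (cantor-block m C q<) ⟩
  (cantor C ∧ cantor q) ∧ cantor d      ≡⟨ ∧-assoc (cantor C) (cantor q) (cantor d) ⟩
  cantor C ∧ (cantor q ∧ cantor d)      ≡⟨ cong (cantor C ∧_) (sym (cantor-digit q (m%n<n r 3))) ⟩
  cantor C ∧ cantor (3 * q + d)         ≡⟨ cong (λ r → cantor C ∧ cantor r) (sym r≡3q+d) ⟩
  cantor C ∧ cantor r                   ∎
  where
  open ≡-Reasoning
  q = r / 3
  d = r % 3
  r≡3q+d : r ≡ 3 * q + d
  r≡3q+d = trans (m≡m%n+[m/n]*n r 3) (trans (+-comm d (q * 3)) (cong (_+ d) (*-comm q 3)))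
  q< : q < 3 ^ m
  q< = m<n*o⇒m/o<n (subst (r <_) (*-comm 3 (3 ^ m)) r<)
  regroup : ∀ C M q d → C * (3 * M) + (3 * q + d) ≡ 3 * (C * M + q) + d
  regroup = solve-∀

cantor-multiple : ∀ m C → cantor (C * 3 ^ m) ≡ cantor C
cantor-multiple m C = begin
  cantor (C * 3 ^ m)         ≡⟨ cong cantor (sym (+-identityʳ (C * 3 ^ m))) ⟩
  cantor (C * 3 ^ m + 0)     ≡⟨ cantor-block m C (m^n>0 3 m) ⟩
  cantor C ∧ true            ≡⟨ ∧-identityʳ (cantor C) ⟩
  cantor C                   ∎
  where open ≡-Reasoning

cantor-window : ∀ m k C D → (∀ {u} → u < k → cantor (C + u) ≡ cantor (D + u)) →
                ∀ {t} → t < k * 3 ^ m → cantor (C * 3 ^ m + t) ≡ cantor (D * 3 ^ m + t)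
cantor-window m k C D agree {t} t< = begin
  cantor (C * M + t)         ≡⟨ cong cantor (regroup C) ⟩
  cantor ((C + u) * M + r)   ≡⟨ cantor-block m (C + u) r<M ⟩
  cantor (C + u) ∧ cantor r  ≡⟨ cong (_∧ cantor r) (agree u<k) ⟩
  cantor (D + u) ∧ cantor r  ≡⟨ sym (cantor-block m (D + u) r<M) ⟩
  cantor ((D + u) * M + r)   ≡⟨ cong cantor (sym (regroup D)) ⟩
  cantor (D * M + t)         ∎
  where
  open ≡-Reasoning
  M = 3 ^ m
  instance
    M≢0 : NonZero M
    M≢0 = m^n≢0 3 m
  u = t / M
  r = t % M
  r<M : r < M
  r<M = m%n<n t M
  u<k : u < k
  u<k = m<n*o⇒m/o<n t<
  regroup : ∀ C → C * M + t ≡ (C + u) * M + r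
  regroup C = trans (cong (C * M +_) (trans (m≡m%n+[m/n]*n t M) (+-comm r (u * M))))
                    (trans (sym (+-assoc (C * M) (u * M) r)) (cong (_+ r) (sym (*-distribʳ-+ M C u))))

factor-zero-block : ∀ m C {n} → cantor C ≡ false → n ≤ 3 ^ m → factor cantor (C * 3 ^ m) n ≡ replicate n false
factor-zero-block m C {n} C-zero n≤ = factor-replicate (C * 3 ^ m) n λ {t} t<n →
  trans (cantor-block m C (<-≤-trans t<n n≤)) (cong (_∧ cantor t) C-zero)

factor-window : ∀ m k C D {n} → (∀ {u} → u < k → cantor (C + u) ≡ cantor (D + u)) → n ≤ k * 3 ^ m →
                factor cantor (C * 3 ^ m) n ≡ factor cantor (D * 3 ^ m) n
factor-window m k C D agree n≤ = factor-cong _ _ _ λ t<n → cantor-window m k C D agree (<-≤-trans t<n n≤)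

suc[3q+2]≡3[1+q] : ∀ q → suc (3 * q + 2) ≡ 3 * suc q
suc[3q+2]≡3[1+q] = solve-∀

data Ternary : ℕ → Set where
  [] : Ternary 0
  _∷0 : ∀ {q} → Ternary q → Ternary (3 * q)
  _∷1 : ∀ {q} → Ternary q → Ternary (3 * q + 1)
  _∷2 : ∀ {q} → Ternary q → Ternary (3 * q + 2)

ternary-suc : ∀ {n} → Ternary n → Ternary (suc n)
ternary-suc [] = [] ∷1
ternary-suc (_∷0 {q} t) = subst Ternary (+-comm (3 * q) 1) (t ∷1)
ternary-suc (_∷1 {q} t) = subst Ternary (+-suc (3 * q) 1) (t ∷2)
ternary-suc (_∷2 {q} t) = subst Ternary (sym (suc[3q+2]≡3[1+q] q)) (ternary-suc t ∷0)

ternary : ∀ n → Ternary n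
ternary zero = []
ternary (suc n) = ternary-suc (ternary n)

-- After a 1 at P come exactly 3^a zeros and then a 1.
one-decomposition : ∀ {P} → Ternary P → cantor P ≡ true →
                    ∃₂ λ a E → cantor E ≡ true × suc P ≡ (3 * E + 1) * 3 ^ a
one-decomposition [] _ = 0 , 0 , refl , refl
one-decomposition (_∷0 {q} _) one = 0 , q , trans (sym (cantor-3q q)) one , shift q
  where
  shift : ∀ q → suc (3 * q) ≡ (3 * q + 1) * 1
  shift = solve-∀
one-decomposition (_∷1 {q} _) one with () ← trans (sym one) (cantor-3q+1 q)
one-decomposition (_∷2 {q} t) one
  with a , E , E-one , eq ← one-decomposition t (trans (sym (cantor-3q+2 q)) one)
  = suc a , E , E-one , trans (suc[3q+2]≡3[1+q] q) (trans (cong (3 *_) eq) (scale E (3 ^ a)))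
  where
  scale : ∀ E M → 3 * ((3 * E + 1) * M) ≡ (3 * E + 1) * (3 * M)
  scale = solve-∀

one-then-zero : ∀ P → cantor P ≡ true → cantor (suc P) ≡ false
one-then-zero P one with a , E , _ , eq ← one-decomposition (ternary P) one = begin
  cantor (suc P)                 ≡⟨ cong cantor eq ⟩
  cantor ((3 * E + 1) * 3 ^ a)   ≡⟨ cantor-multiple a (3 * E + 1) ⟩
  cantor (3 * E + 1)             ≡⟨ cantor-3q+1 E ⟩
  false                          ∎
  where open ≡-Reasoning

cantor-pred-3^ : ∀ m → cantor (pred (3 ^ m)) ≡ true
cantor-pred-3^ zero = refl
cantor-pred-3^ (suc m) = trans (cong cantor pred-3^[1+m]) (trans (cantor-3q+2 (pred (3 ^ m))) (cantor-pred-3^ m))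
  where
  pred-3^[1+m] : pred (3 ^ suc m) ≡ 3 * pred (3 ^ m) + 2
  pred-3^[1+m] = cong pred (trans (cong (3 *_) (sym (suc-pred (3 ^ m) {{m^n≢0 3 m}})))
                                  (sym (suc[3q+2]≡3[1+q] (pred (3 ^ m)))))

ZeroRunBeforeOne : ℕ → ℕ → Set
ZeroRunBeforeOne a j = (∀ {u} → u ≤ 3 ^ a → cantor (j + u) ≡ false) × cantor (j + suc (3 ^ a)) ≡ true

-- Reading every third letter of a long zero run before a 1 gives a run a third as long.
zero-run-scale : ∀ a j → ZeroRunBeforeOne (suc a) j → ∃ λ q → 3 * q + 2 ≡ j × ZeroRunBeforeOne a q
zero-run-scale a j (zeros , one) with ternary j
... | [] with () ← zeros z≤n
... | _∷0 {q} _ =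
  contradiction (trans (sym one) (trans (cong cantor (regroup q (3 ^ a))) (cantor-3q+1 (q + 3 ^ a)))) λ ()
  where
  regroup : ∀ q M → 3 * q + suc (3 * M) ≡ 3 * (q + M) + 1
  regroup = solve-∀
... | _∷1 {q} _ = contradiction (begin
  true                              ≡⟨ sym one ⟩
  cantor (3 * q + 1 + suc (3 * M))  ≡⟨ cong cantor (regroup q M) ⟩
  cantor (3 * (q + M) + 2)          ≡⟨ cantor-3q+2 (q + M) ⟩
  cantor (q + M)                    ≡⟨ sym (cantor-3q (q + M)) ⟩
  cantor (3 * (q + M))              ≡⟨ cong cantor 3[q+M]≡3q+1+[3N+2] ⟩
  cantor (3 * q + 1 + (3 * N + 2))  ≡⟨ zeros 3N+2≤3M ⟩
  false                             ∎) λ ()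
  where
  open ≡-Reasoning
  M = 3 ^ a
  N = pred M
  1+N≡M : suc N ≡ M
  1+N≡M = suc-pred M {{m^n≢0 3 a}}
  regroup : ∀ q M → 3 * q + 1 + suc (3 * M) ≡ 3 * (q + M) + 2
  regroup = solve-∀
  3[q+M]≡3q+1+[3N+2] : 3 * (q + M) ≡ 3 * q + 1 + (3 * N + 2)
  3[q+M]≡3q+1+[3N+2] = trans (cong (λ M → 3 * (q + M)) (sym 1+N≡M)) (regroupᴺ q N)
    where
    regroupᴺ : ∀ q N → 3 * (q + suc N) ≡ 3 * q + 1 + (3 * N + 2)
    regroupᴺ = solve-∀
  3N+2≤3M : 3 * N + 2 ≤ 3 * M
  3N+2≤3M = ≤-trans (n≤1+n _) (≤-reflexive (trans (suc[3q+2]≡3[1+q] N) (cong (3 *_) 1+N≡M)))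
... | _∷2 {q} _ = q , refl , zeros′ , one′
  where
  M = 3 ^ a
  regroup : ∀ q u → 3 * q + 2 + 3 * u ≡ 3 * (q + u) + 2
  regroup = solve-∀
  regroup′ : ∀ q M → 3 * (q + suc M) ≡ 3 * q + 2 + suc (3 * M)
  regroup′ = solve-∀
  zeros′ : ∀ {u} → u ≤ M → cantor (q + u) ≡ false
  zeros′ {u} u≤M =
    trans (sym (cantor-3q+2 (q + u))) (trans (cong cantor (sym (regroup q u))) (zeros (*-monoʳ-≤ 3 u≤M)))
  one′ : cantor (q + suc M) ≡ true
  one′ = trans (sym (cantor-3q (q + suc M))) (trans (cong cantor (regroup′ q M)) one)

zero-run-before-one : ∀ a j → ZeroRunBeforeOne a j → ∃ λ G → j + suc (3 ^ a) ≡ G * 3 ^ suc a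
zero-run-before-one zero j (zeros , one) with ternary j
... | [] with () ← zeros z≤n
... | _∷0 {q} _ = contradiction (begin
  true                ≡⟨ sym one ⟩
  cantor (3 * q + 2)  ≡⟨ cantor-3q+2 q ⟩
  cantor q            ≡⟨ sym (cantor-3q q) ⟩
  cantor (3 * q)      ≡⟨ cong cantor (sym (+-identityʳ (3 * q))) ⟩
  cantor (3 * q + 0)  ≡⟨ zeros z≤n ⟩
  false               ∎) λ ()
  where open ≡-Reasoning
... | _∷1 {q} _ = suc q , 3q+1+2 q
  where
  3q+1+2 : ∀ q → 3 * q + 1 + 2 ≡ suc q * (3 * 1)
  3q+1+2 = solve-∀
... | _∷2 {q} _ = contradiction (trans (sym one) (trans (cong cantor (3q+2+2 q)) (cantor-3q+1 (suc q)))) λ ()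
  where
  3q+2+2 : ∀ q → 3 * q + 2 + 2 ≡ 3 * suc q + 1
  3q+2+2 = solve-∀
zero-run-before-one (suc a) j run with q , refl , run′ ← zero-run-scale a j run =
  map₂ (λ {G} → scale G) (zero-run-before-one a q run′)
  where
  scale : ∀ G → q + suc (3 ^ a) ≡ G * 3 ^ suc a → 3 * q + 2 + suc (3 ^ suc a) ≡ G * 3 ^ suc (suc a)
  scale G eq = trans (regroup q (3 ^ a)) (trans (cong (3 *_) eq) (3[G*K]≡G*3K G (3 ^ suc a)))
    where
    regroup : ∀ q M → 3 * q + 2 + suc (3 * M) ≡ 3 * (q + suc M)
    regroup = solve-∀
    3[G*K]≡G*3K : ∀ G K → 3 * (G * K) ≡ G * (3 * K)
    3[G*K]≡G*3K = solve-∀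

-- Left special factors of the Cantor string

factor-after-one : ∀ a E {n} → cantor E ≡ true → n ≤ 3 ^ suc a →
                   factor cantor ((3 * E + 1) * 3 ^ a) n ≡ factor cantor (3 ^ a) n
factor-after-one a E E-one n≤ =
  trans (factor-window a 3 (3 * E + 1) 1 agree n≤) (cong (λ i → factor cantor i _) (*-identityˡ (3 ^ a)))
  where
  agree : ∀ {u} → u < 3 → cantor (3 * E + 1 + u) ≡ cantor (1 + u)
  agree {0} _ = trans (cong cantor (+-identityʳ (3 * E + 1))) (cantor-3q+1 E)
  agree {1} _ = trans (cong cantor (+-assoc (3 * E) 1 1)) (trans (cantor-3q+2 E) E-one)
  agree {2} _ = begin
    cantor (3 * E + 1 + 2) ≡⟨ cong cantor (carry E) ⟩
    cantor (3 * suc E)     ≡⟨ cantor-3q (suc E) ⟩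
    cantor (suc E)         ≡⟨ one-then-zero E E-one ⟩
    false                  ∎
    where
    open ≡-Reasoning
    carry : ∀ E → 3 * E + 1 + 2 ≡ 3 * suc E
    carry = solve-∀
  agree {suc (suc (suc _))} (s≤s (s≤s (s≤s ())))

leftSpecial-zero-run : ∀ a E j {n} → cantor E ≡ true → 3 ^ a < n → cantor j ≡ false →
  factor cantor (suc j) n ≡ factor cantor ((3 * E + 1) * 3 ^ a) n → ZeroRunBeforeOne a j
leftSpecial-zero-run a E j {n} E-one M<n j-zero same = zeros , one
  where
  open ≡-Reasoning
  M = 3 ^ a
  F = (3 * E + 1) * M
  same-at : ∀ {t} → t < n → cantor (suc j + t) ≡ cantor (F + t)
  same-at = factor-pointwise (suc j) F n same
  zeros : ∀ {u} → u ≤ M → cantor (j + u) ≡ false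
  zeros {zero} _ = trans (cong cantor (+-identityʳ j)) j-zero
  zeros {suc t} t<M = begin
    cantor (j + suc t)             ≡⟨ cong cantor (+-suc j t) ⟩
    cantor (suc j + t)             ≡⟨ same-at (<-trans t<M M<n) ⟩
    cantor (F + t)                 ≡⟨ cantor-block a (3 * E + 1) t<M ⟩
    cantor (3 * E + 1) ∧ cantor t  ≡⟨ cong (_∧ cantor t) (cantor-3q+1 E) ⟩
    false                          ∎
  one : cantor (j + suc M) ≡ true
  one = begin
    cantor (j + suc M)        ≡⟨ cong cantor (+-suc j M) ⟩
    cantor (suc j + M)        ≡⟨ same-at M<n ⟩
    cantor (F + M)            ≡⟨ cong cantor (next-block E M) ⟩
    cantor ((3 * E + 2) * M)  ≡⟨ cantor-multiple a (3 * E + 2) ⟩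
    cantor (3 * E + 2)        ≡⟨ cantor-3q+2 E ⟩
    cantor E                  ≡⟨ E-one ⟩
    true                      ∎
    where
    next-block : ∀ E M → (3 * E + 1) * M + M ≡ (3 * E + 2) * M
    next-block = solve-∀

-- The occurrence of 0w is aligned so that offset 3^(a+1) lands on a 1 (block 3G + 2), while in the
-- occurrence of 1w it lands on a 0 (block 3(E + 1) + 1).
leftSpecial-length-bound : ∀ a E j {n} → cantor E ≡ true → 3 ^ a < n → cantor j ≡ false →
  factor cantor (suc j) n ≡ factor cantor ((3 * E + 1) * 3 ^ a) n → n ≤ 3 ^ suc a
leftSpecial-length-bound a E j {n} E-one M<n j-zero same = ≮⇒≥ λ 3M<n → contradiction (begin
  true                          ≡⟨ sym G-one ⟩
  cantor G                      ≡⟨ sym (cantor-3q+2 G) ⟩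
  cantor (3 * G + 2)            ≡⟨ sym (cantor-multiple a (3 * G + 2)) ⟩
  cantor ((3 * G + 2) * M)      ≡⟨ cong cantor (sym (regroupʲ G M)) ⟩
  cantor (G * (3 * M) + 2 * M)  ≡⟨ cong (λ k → cantor (k + 2 * M)) (sym eq) ⟩
  cantor (j + suc M + 2 * M)    ≡⟨ cong cantor (regroup j M) ⟩
  cantor (suc j + 3 * M)        ≡⟨ factor-pointwise (suc j) _ n same 3M<n ⟩
  cantor ((3 * E + 1) * M + 3 * M) ≡⟨ cong cantor (regroupⁱ E M) ⟩
  cantor ((3 * suc E + 1) * M)  ≡⟨ cantor-multiple a (3 * suc E + 1) ⟩
  cantor (3 * suc E + 1)        ≡⟨ cantor-3q+1 (suc E) ⟩
  false                         ∎) λ ()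
  where
  open ≡-Reasoning
  M = 3 ^ a
  run = leftSpecial-zero-run a E j E-one M<n j-zero same
  G = proj₁ (zero-run-before-one a j run)
  eq : j + suc M ≡ G * (3 * M)
  eq = proj₂ (zero-run-before-one a j run)
  G-one : cantor G ≡ true
  G-one = trans (sym (cantor-multiple (suc a) G)) (trans (cong cantor (sym eq)) (proj₂ run))
  regroupʲ : ∀ G M → G * (3 * M) + 2 * M ≡ (3 * G + 2) * M
  regroupʲ = solve-∀
  regroup : ∀ j M → j + suc M + 2 * M ≡ suc j + 3 * M
  regroup = solve-∀
  regroupⁱ : ∀ E M → (3 * E + 1) * M + 3 * M ≡ (3 * suc E + 1) * M
  regroupⁱ = solve-∀

leftSpecial-cases : ∀ {n w} → LeftSpecial cantor n w →
  w ≡ replicate n false ⊎ ∃ λ a → 3 ^ a < n × n ≤ 3 ^ suc a × w ≡ factor cantor (3 ^ a) n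
leftSpecial-cases {n} {w} ((j , 0w) , (i , 1w))
  with a , E , E-one , 1+i≡ ← one-decomposition (ternary i) (∷-injectiveˡ 1w)
  with F≡w ← trans (cong (λ k → factor cantor k n) (sym 1+i≡)) (∷-injectiveʳ 1w)
  with n ≤? 3 ^ a
... | yes n≤M = inj₁ (trans (sym F≡w) (factor-zero-block a (3 * E + 1) (cantor-3q+1 E) n≤M))
... | no n≰M = inj₂ (a , ≰⇒> n≰M , aligned (leftSpecial-length-bound a E j E-one (≰⇒> n≰M) (∷-injectiveˡ 0w)
                                                                    (trans (∷-injectiveʳ 0w) (sym F≡w))))
  where
  aligned : n ≤ 3 ^ suc a → n ≤ 3 ^ suc a × w ≡ factor cantor (3 ^ a) n
  aligned n≤3M = n≤3M , trans (sym F≡w) (factor-after-one a E E-one n≤3M)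

factor-3^-zeros : ∀ m {n} → n ≤ 3 ^ m → factor cantor (3 ^ m) n ≡ replicate n false
factor-3^-zeros m {n} n≤ =
  trans (cong (λ i → factor cantor i n) (sym (*-identityˡ (3 ^ m)))) (factor-zero-block m 1 refl n≤)

zeros-leftSpecial : ∀ n → LeftSpecial cantor n (replicate n false)
zeros-leftSpecial n =
  (3 ^ n , factor-3^-zeros n (n<3^n n)) ,
  (pred (3 ^ n) , cong₂ _∷_ (cantor-pred-3^ n)
                            (trans (cong (λ i → factor cantor i n) (suc-pred (3 ^ n) {{m^n≢0 3 n}}))
                                   (factor-3^-zeros n (<⇒≤ (n<3^n n)))))

power-leftSpecial : ∀ a {n} → n ≤ 3 ^ suc a → LeftSpecial cantor n (factor cantor (3 ^ a) n)
power-leftSpecial a {n} n≤ =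
  (4 * M + N , cong₂ _∷_ (cantor-block a 4 N<M) (begin
     factor cantor (suc (4 * M + N)) n  ≡⟨ cong (λ i → factor cantor i n) 1+4M+N≡5M ⟩
     factor cantor (5 * M) n            ≡⟨ factor-window a 3 5 1 agree n≤ ⟩
     factor cantor (1 * M) n            ≡⟨ cong (λ i → factor cantor i n) (*-identityˡ M) ⟩
     factor cantor M n                  ∎)) ,
  (N , cong₂ _∷_ (cantor-pred-3^ a) (cong (λ i → factor cantor i n) 1+N≡M))
  where
  open ≡-Reasoning
  M = 3 ^ a
  N = pred M
  1+N≡M : suc N ≡ M
  1+N≡M = suc-pred M {{m^n≢0 3 a}}
  N<M : N < M
  N<M = ≤-reflexive 1+N≡M
  1+4M+N≡5M : suc (4 * M + N) ≡ 5 * M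
  1+4M+N≡5M = trans (sym (+-suc (4 * M) N)) (trans (cong (4 * M +_) 1+N≡M) (4M+M≡5M M))
    where
    4M+M≡5M : ∀ M → 4 * M + M ≡ 5 * M
    4M+M≡5M = solve-∀
  agree : ∀ {u} → u < 3 → cantor (5 + u) ≡ cantor (1 + u)
  agree {0} _ = refl
  agree {1} _ = refl
  agree {2} _ = refl
  agree {suc (suc (suc _))} (s≤s (s≤s (s≤s ())))

power-factor≢zeros : ∀ a {n} → 3 ^ a < n → factor cantor (3 ^ a) n ≢ replicate n false
power-factor≢zeros a {n} M<n eq = contradiction (begin
  true                  ≡⟨ sym (cantor-multiple a 2) ⟩
  cantor (2 * 3 ^ a)    ≡⟨ cong cantor (M+M≡2M (3 ^ a)) ⟩
  cantor (3 ^ a + 3 ^ a) ≡⟨ factor-pointwise (3 ^ a) 0 n (trans eq (sym (factor-const false 0 n))) M<n ⟩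
  false                 ∎) λ ()
  where
  open ≡-Reasoning
  M+M≡2M : ∀ M → 2 * M ≡ M + M
  M+M≡2M = solve-∀

3^-bracket : ∀ n → 1 < n → ∃ λ a → 3 ^ a < n × n ≤ 3 ^ suc a
3^-bracket (suc zero) (s≤s ())
3^-bracket (suc (suc zero)) _ = 0 , s≤s (s≤s z≤n) , s≤s (s≤s z≤n)
3^-bracket (suc n@(suc (suc _))) _ with a , M<n , n≤3M ← 3^-bracket n (s≤s (s≤s z≤n)) | suc n ≤? 3 ^ suc a
... | yes 1+n≤3M = a , m<n⇒m<1+n M<n , 1+n≤3M
... | no 1+n≰3M = suc a , ≰⇒> 1+n≰3M , ≤-trans (s≤s n≤3M) (1+K≤3K (3 ^ suc a) (m^n>0 3 (suc a)))
  where
  1+K≤3K : ∀ K → 0 < K → suc K ≤ 3 * K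
  1+K≤3K K 0<K = ≤-trans (+-monoˡ-≤ K 0<K) (+-monoʳ-≤ K (m≤m+n K _))

3^-bracket-unique : ∀ {n} a b → 3 ^ a < n → n ≤ 3 ^ suc a → 3 ^ b < n → n ≤ 3 ^ suc b → a ≡ b
3^-bracket-unique {n} a b 3^a<n n≤3^[1+a] 3^b<n n≤3^[1+b] with <-cmp a b
... | tri< a<b _ _ = contradiction (≤-trans n≤3^[1+a] (^-monoʳ-≤ 3 a<b)) (<⇒≱ 3^b<n)
... | tri≈ _ a≡b _ = a≡b
... | tri> _ _ b<a = contradiction (≤-trans n≤3^[1+b] (^-monoʳ-≤ 3 b<a)) (<⇒≱ 3^a<n)

factor-recurrence : ∀ i n → factor cantor (2 * 3 ^ (i + n) + i) n ≡ factor cantor i n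
factor-recurrence i n = factor-cong _ i n λ {t} t<n → begin
  cantor (2 * K + i + t)          ≡⟨ cong cantor (+-assoc (2 * K) i t) ⟩
  cantor (2 * K + (i + t))        ≡⟨ cantor-block (i + n) 2 (<-≤-trans (+-monoʳ-< i t<n) (<⇒≤ (n<3^n (i + n)))) ⟩
  cantor (i + t)                  ∎
  where
  open ≡-Reasoning
  K = 3 ^ (i + n)

cantor-leftExtendable : ∀ n → LeftExtendable cantor n
cantor-leftExtendable n _ (i , refl) =
  cantor p , p , cong (cantor p ∷_) (trans (cong (λ j → factor cantor j n) 1+p≡) (factor-recurrence i n))
  where
  K = 3 ^ (i + n)
  p = pred K + K + i
  1+p≡ : suc p ≡ 2 * K + i
  1+p≡ = cong (_+ i) (trans (cong (_+ K) (suc-pred K {{m^n≢0 3 (i + n)}})) (cong (K +_) (sym (+-identityʳ K))))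

leftSpecials : ℕ → ℕ → List (List Bool)
leftSpecials a n = replicate n false ∷ factor cantor (3 ^ a) n ∷ []

∈-leftSpecials⇔ : ∀ a {n} → 3 ^ a < n → n ≤ 3 ^ suc a →
                  ∀ {w} → w ∈ leftSpecials a n ⇔ LeftSpecial cantor n w
∈-leftSpecials⇔ a {n} 3^a<n n≤3^[1+a] = mk⇔ special classify
  where
  special : ∀ {w} → w ∈ leftSpecials a n → LeftSpecial cantor n w
  special (here refl) = zeros-leftSpecial n
  special (there (here refl)) = power-leftSpecial a n≤3^[1+a]
  classify : ∀ {w} → LeftSpecial cantor n w → w ∈ leftSpecials a n
  classify s with leftSpecial-cases s
  ... | inj₁ w≡zeros = here w≡zeros
  ... | inj₂ (b , 3^b<n , n≤3^[1+b] , w≡) =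
    there (here (trans w≡ (cong (λ c → factor cantor (3 ^ c) n)
                                (3^-bracket-unique b a 3^b<n n≤3^[1+b] 3^a<n n≤3^[1+a]))))

unique-leftSpecials : ∀ a {n} → 3 ^ a < n → Unique (leftSpecials a n)
unique-leftSpecials a 3^a<n = ((power-factor≢zeros a 3^a<n ∘ sym) ∷ []) ∷ [] ∷ []

cantor-complexity-suc : ∀ n → 1 < n → ∀ {k} → Complexity cantor n k → Complexity cantor (suc n) (k + 2)
cantor-complexity-suc n 1<n with a , 3^a<n , n≤3^[1+a] ← 3^-bracket n 1<n =
  LeftExtensions.complexity-suc cantor n (leftSpecials a n) (∈-leftSpecials⇔ a 3^a<n n≤3^[1+a])
                                (cantor-leftExtendable n) (unique-leftSpecials a 3^a<n)

complexity-2 : Complexity cantor 2 3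
complexity-2 = ws , unique , refl , factor⇔
  where
  ws = (false ∷ false ∷ []) ∷ (false ∷ true ∷ []) ∷ (true ∷ false ∷ []) ∷ []
  unique : Unique ws
  unique = ((λ ()) ∷ (λ ()) ∷ []) ∷ ((λ ()) ∷ []) ∷ [] ∷ []
  no-11 : ∀ b c → (b ≡ true → c ≡ false) → (b ∷ c ∷ []) ∈ ws
  no-11 false false _ = here refl
  no-11 false true _ = there (here refl)
  no-11 true false _ = there (there (here refl))
  no-11 true true 1⇒0 with () ← 1⇒0 refl
  factor⇔ : ∀ w → (w ∈ ws → IsFactor cantor 2 w) × (IsFactor cantor 2 w → w ∈ ws)
  factor⇔ w = occurrence , λ { (i , refl) → no-11 (cantor i) (cantor (suc i)) (one-then-zero i) }
    where
    occurrence : w ∈ ws → IsFactor cantor 2 w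
    occurrence (here refl) = 3 , refl
    occurrence (there (here refl)) = 1 , refl
    occurrence (there (there (here refl))) = 0 , refl

complexity-2+m : ∀ m → Complexity cantor (2 + m) (3 + 2 * m)
complexity-2+m zero = complexity-2
complexity-2+m (suc m) =
  subst (Complexity cantor (3 + m)) (3+2m+2≡3+2[1+m] m)
        (cantor-complexity-suc (2 + m) (s≤s (s≤s z≤n)) (complexity-2+m m))
  where
  3+2m+2≡3+2[1+m] : ∀ m → 3 + 2 * m + 2 ≡ 3 + 2 * suc m
  3+2m+2≡3+2[1+m] = solve-∀

theorem1 : ∀ (n : ℕ) → 1 < n → Complexity cantor n (2 * n ∸ 1)
theorem1 (suc (suc m)) _ = subst (Complexity cantor (2 + m)) (cong (_∸ 1) (sym (2[2+m]≡4+2m m))) (complexity-2+m m)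
  where
  2[2+m]≡4+2m : ∀ m → 2 * (2 + m) ≡ 4 + 2 * m
  2[2+m]≡4+2m = solve-∀
theorem1 (suc zero) (s≤s ())
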